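{- In every digraph $G=(V,A)$ with $V\neq\emptyset$ there exists a node $t\in V$ such that $\varrho_G(Z)\ge \mu(G)/2$ for every non-empty $Z\subseteq V\setminus\{t\}$.
   Context: $\varrho_G(Z)$ denotes the number of arcs of $G$ entering $Z$. $\mu(G)=\min\{\varrho_G(Z_1)+\varrho_G(Z_2): Z_1,Z_2\subsetneq V \text{ non-empty},\ Z_1\cap Z_2=\emptyset\}$ is the minimum cardinality of a double cut (with $\min\emptyset=+\infty$). -}

module Defs where

open import Data.Nat using (ℕ; zero; suc; _+_; _⊓_; _≤_)
open import Data.Bool using (Bool; true; false; not; _∧_)
open import Data.Fin using (Fin)
open import Data.Fin.Subset using (Subset; Nonempty; Empty; ∁; _∩_)
open import Data.Fin.Subset.Properties using (nonempty?)
open import Data.Vec using (Vec; []; _∷_; lookup)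
open import Data.List using (List; []; _∷_; map; filter; length; concatMap; cartesianProduct)
open import Data.Product using (_×_; _,_)
open import Data.Maybe using (Maybe; just; nothing)
open import Data.Empty using (⊥)
open import Relation.Nullary using (Dec; yes; no; ¬_)
open import Relation.Nullary.Decidable using (_×-dec_; ¬?)

-- A digraph on the vertex set Fin n, given by its list of arcs (tail , head).
-- Parallel arcs (and loops) are allowed.
record Digraph : Set where
  constructor digraph
  field
    n    : ℕ
    arcs : List (Fin n × Fin n)
open Digraph public

enters : ∀ {n} → Subset n → Fin n × Fin n → Bool
enters Z (u , v) = not (lookup Z u) ∧ lookup Z v

ϱ : (G : Digraph) → Subset (n G) → ℕ
ϱ G Z = length (filter (λ a → enters Z a Data.Bool.≟ true) (arcs G))

subsets : (n : ℕ) → List (Subset n)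
subsets zero = [] ∷ []
subsets (suc n) = concatMap (λ s → (true ∷ s) ∷ (false ∷ s) ∷ []) (subsets n)

NonemptyProper : ∀ {n} → Subset n → Set
NonemptyProper Z = Nonempty Z × Nonempty (∁ Z)

IsDoubleCut : ∀ {n} → Subset n × Subset n → Set
IsDoubleCut (Z₁ , Z₂) = NonemptyProper Z₁ × NonemptyProper Z₂ × ¬ Nonempty (Z₁ ∩ Z₂)

isDoubleCut? : ∀ {n} (p : Subset n × Subset n) → Dec (IsDoubleCut p)
isDoubleCut? (Z₁ , Z₂) =
  (nonempty? Z₁ ×-dec nonempty? (∁ Z₁)) ×-dec
  ((nonempty? Z₂ ×-dec nonempty? (∁ Z₂)) ×-dec ¬? (nonempty? (Z₁ ∩ Z₂)))

-- ℕ ∪ {+∞}, represented by Maybe ℕ with nothing = +∞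
ℕ∞ : Set
ℕ∞ = Maybe ℕ

min∞ : ℕ∞ → ℕ∞ → ℕ∞
min∞ nothing y = y
min∞ (just x) nothing = just x
min∞ (just x) (just y) = just (x ⊓ y)

minimum∞ : List ℕ → ℕ∞
minimum∞ [] = nothing
minimum∞ (x ∷ xs) = min∞ (just x) (minimum∞ xs)

μ : Digraph → ℕ∞
μ G = minimum∞ (map (λ { (Z₁ , Z₂) → ϱ G Z₁ + ϱ G Z₂ })
                    (filter isDoubleCut? (cartesianProduct (subsets (n G)) (subsets (n G)))))

_≤∞_ : ℕ∞ → ℕ → Set
nothing ≤∞ k = ⊥
just m ≤∞ k = m ≤ k

module Submission where

-- Call Z light if Z is a non-empty proper subset with 2 ϱ(Z) < μ. The light sets
-- have a common point t, which is the required node. By a Helly-type induction it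
-- suffices to refute a family X₀ … X_k of light sets without a common point in which
-- any k members share a point. Then Yᵢ = ⋂_{j ≠ i} Xⱼ is non-empty and disjoint
-- from Xᵢ, so each (Yᵢ , Xᵢ) is a double cut. The Yᵢ are pairwise disjoint and an
-- arc entering Yᵢ enters some Xⱼ, hence Σ ϱ(Yᵢ) ≤ Σ ϱ(Xᵢ), and
--   (k+1) μ ≤ Σ (ϱ(Yᵢ) + ϱ(Xᵢ)) ≤ 2 Σ ϱ(Xᵢ) < (k+1) μ.

open import Defs
open import Data.Nat using (ℕ; suc; _*_)
open import Data.Fin using (Fin)
open import Data.Fin.Subset using (Subset; Nonempty; _∉_)
open import Data.Product using (Σ)

open import Data.Nat using (zero; _+_; _≤_; _<_; z≤n; _≤?_; _<?_)
open import Data.Nat.Properties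
  using ( ≤-refl; ≤-trans; <⇒≤; <-irrefl; <-≤-trans; ≰⇒>; m≤m+n; m≤n+m; m⊓n≤m; m⊓n≤n; +-identityʳ
        ; +-mono-≤; +-monoˡ-≤; +-monoʳ-≤; +-mono-<-≤; +-0-commutativeMonoid; module ≤-Reasoning)
open import Data.Bool using (Bool; true; false; not; _∧_) renaming (_≟_ to _≟ᵇ_)
open import Data.Fin using (zero; suc; punchIn; punchOut) renaming (_≟_ to _≟ᶠ_)
open import Data.Fin.Properties using (any?; all?; ¬∀⟶∃¬; punchIn-punchOut; suc-injective)
open import Data.Fin.Subset using (∁; _∩_; _∈_)
open import Data.Fin.Subset.Properties using (nonempty?; _∈?_; x∈p⇒x∉∁p; x∈∁p⇒x∉p; x∉p⇒x∈∁p; p∩q⊆p; p∩q⊆q)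
open import Data.Vec using (tabulate; lookup)
import Data.Vec as Vec
open import Data.Vec.Properties using ([]=⇒lookup; lookup⇒[]=; lookup∘tabulate)
open import Data.List using (List; []; _∷_; filter; length)
import Data.List as List
open import Data.List.Membership.Propositional using () renaming (_∈_ to _∈ₗ_)
open import Data.List.Membership.Propositional.Properties
  using (∈-concatMap⁺; ∈-map⁺; ∈-filter⁺; ∈-filter⁻; ∈-cartesianProduct⁺; ∈-lookup)
open import Data.List.Relation.Unary.Any using (here; there; index)
import Data.List.Relation.Unary.Any as Any
open import Data.List.Relation.Unary.Any.Properties using (lookup-index)
open import Data.Product using (_×_; _,_; proj₁; proj₂; ∃)
open import Data.Maybe using (just; nothing)
open import Data.Empty using (⊥; ⊥-elim)
open import Function using (_∘_)
open import Relation.Nullary using (Dec; yes; no; ¬_; contradiction)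
open import Relation.Nullary.Decidable using (does; dec-true; dec-false; decidable-stable; _×-dec_)
open import Relation.Unary using (Decidable)
open import Relation.Binary.PropositionalEquality

open import Algebra.Properties.CommutativeMonoid.Sum +-0-commutativeMonoid
  using (sum; sum-cong-≗; ∑-distrib-+)

𝟙 : Bool → ℕ
𝟙 true  = 1
𝟙 false = 0

∑-mono-≤ : ∀ {k} {f g : Fin k → ℕ} → (∀ i → f i ≤ g i) → sum f ≤ sum g
∑-mono-≤ {zero}  f≤g = z≤n
∑-mono-≤ {suc k} f≤g = +-mono-≤ (f≤g zero) (∑-mono-≤ (f≤g ∘ suc))

∑-mono-< : ∀ {k} {f g : Fin (suc k) → ℕ} → (∀ i → f i < g i) → sum f < sum g
∑-mono-< f<g = +-mono-<-≤ (f<g zero) (∑-mono-≤ (<⇒≤ ∘ f<g ∘ suc))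

f≤∑f : ∀ {k} (f : Fin k → ℕ) i → f i ≤ sum f
f≤∑f f zero    = m≤m+n _ _
f≤∑f f (suc i) = ≤-trans (f≤∑f (f ∘ suc) i) (m≤n+m _ (f zero))

AtMostOnce : ∀ {k} → (Fin k → Bool) → Set
AtMostOnce p = ∀ i j → p i ≡ true → p j ≡ true → i ≡ j

atMostOnce-suc : ∀ {k} {p : Fin (suc k) → Bool} → AtMostOnce p → AtMostOnce (p ∘ suc)
atMostOnce-suc once i j pi pj = suc-injective (once (suc i) (suc j) pi pj)

∑-𝟙-≤ : ∀ {k} (p : Fin k → Bool) {r : ℕ} → AtMostOnce p → (∀ i → p i ≡ true → 1 ≤ r) → sum (𝟙 ∘ p) ≤ r
∑-𝟙-≤ {zero}  p once r≥1 = z≤n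
∑-𝟙-≤ {suc k} p once r≥1 with p zero in p₀
... | false = ∑-𝟙-≤ (p ∘ suc) (atMostOnce-suc once) (r≥1 ∘ suc)
... | true  = ≤-trans (+-monoʳ-≤ 1 (∑-𝟙-≤ (p ∘ suc) (atMostOnce-suc once) rest-false)) (r≥1 zero p₀)
  where
  rest-false : ∀ i → p (suc i) ≡ true → 1 ≤ 0
  rest-false i pi with once zero (suc i) p₀ pi
  ... | ()

-- ϱ G Z is definitionally count (enters Z) (arcs G).
count : ∀ {A : Set} → (A → Bool) → List A → ℕ
count p xs = length (filter (λ x → p x ≟ᵇ true) xs)

count-∷ : ∀ {A : Set} (p : A → Bool) x xs → count p (x ∷ xs) ≡ 𝟙 (p x) + count p xs
count-∷ p x xs with p x
... | true  = refl
... | false = refl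

∑-count-mono : ∀ {A : Set} {k} (P Q : Fin k → A → Bool) →
  (∀ x → sum (λ i → 𝟙 (P i x)) ≤ sum (λ i → 𝟙 (Q i x))) →
  ∀ xs → sum (λ i → count (P i) xs) ≤ sum (λ i → count (Q i) xs)
∑-count-mono P Q pointwise [] = ≤-refl
∑-count-mono P Q pointwise (x ∷ xs) = begin
  sum (λ i → count (P i) (x ∷ xs))                       ≡⟨ sum-cong-≗ (λ i → count-∷ (P i) x xs) ⟩
  sum (λ i → 𝟙 (P i x) + count (P i) xs)                  ≡⟨ ∑-distrib-+ (λ i → 𝟙 (P i x)) (λ i → count (P i) xs) ⟩
  sum (λ i → 𝟙 (P i x)) + sum (λ i → count (P i) xs)      ≤⟨ +-mono-≤ (pointwise x) (∑-count-mono P Q pointwise xs) ⟩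
  sum (λ i → 𝟙 (Q i x)) + sum (λ i → count (Q i) xs)      ≡⟨ ∑-distrib-+ (λ i → 𝟙 (Q i x)) (λ i → count (Q i) xs) ⟨
  sum (λ i → 𝟙 (Q i x) + count (Q i) xs)                  ≡⟨ sum-cong-≗ (λ i → count-∷ (Q i) x xs) ⟨
  sum (λ i → count (Q i) (x ∷ xs))                       ∎
  where open ≤-Reasoning

∈-subsets : ∀ {n} (Z : Subset n) → Z ∈ₗ subsets n
∈-subsets Vec.[]          = here refl
∈-subsets (true  Vec.∷ Z) = ∈-concatMap⁺ _ (Any.map (λ { refl → here refl }) (∈-subsets Z))
∈-subsets (false Vec.∷ Z) = ∈-concatMap⁺ _ (Any.map (λ { refl → there (here refl) }) (∈-subsets Z))

minimum∞-≤ : ∀ {x xs} → x ∈ₗ xs → minimum∞ xs ≤∞ x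
minimum∞-≤ {xs = y ∷ ys} (here refl) with minimum∞ ys
... | nothing = ≤-refl
... | just z  = m⊓n≤m y z
minimum∞-≤ {xs = y ∷ ys} (there x∈ys) with minimum∞ ys | minimum∞-≤ x∈ys
... | just z | z≤x = ≤-trans (m⊓n≤n y z) z≤x

μ-≤ : (G : Digraph) {Z₁ Z₂ : Subset (n G)} → IsDoubleCut (Z₁ , Z₂) → μ G ≤∞ (ϱ G Z₁ + ϱ G Z₂)
μ-≤ G {Z₁} {Z₂} cut =
  minimum∞-≤ (∈-map⁺ _ (∈-filter⁺ isDoubleCut? (∈-cartesianProduct⁺ (∈-subsets Z₁) (∈-subsets Z₂)) cut))

∉⇒lookup≡false : ∀ {k} {Z : Subset k} {x} → x ∉ Z → lookup Z x ≡ false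
∉⇒lookup≡false {Z = Z} {x} x∉Z with lookup Z x in eq
... | false = refl
... | true  = contradiction (lookup⇒[]= x Z eq) x∉Z

enters⁺ : ∀ {k} {Z : Subset k} {u v} → u ∉ Z → v ∈ Z → enters Z (u , v) ≡ true
enters⁺ u∉Z v∈Z = cong₂ (λ a b → not a ∧ b) (∉⇒lookup≡false u∉Z) ([]=⇒lookup v∈Z)

enters⁻ : ∀ {k} {Z : Subset k} {u v} → enters Z (u , v) ≡ true → u ∉ Z × v ∈ Z
enters⁻ {Z = Z} {u} {v} e with lookup Z u in eu | lookup Z v in ev
... | false | true = (λ u∈Z → contradiction (trans (sym ([]=⇒lookup u∈Z)) eu) λ ()) , lookup⇒[]= v Z ev

doubleCut-∁ : ∀ {k} {Z : Subset k} → NonemptyProper Z → IsDoubleCut (Z , ∁ Z)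
doubleCut-∁ ((x , x∈Z) , ∁Z≠∅) =
  ((x , x∈Z) , ∁Z≠∅) , (∁Z≠∅ , (x , x∉p⇒x∈∁p (x∈p⇒x∉∁p x∈Z))) ,
  λ { (y , y∈) → x∈∁p⇒x∉p (p∩q⊆q _ _ y∈) (p∩q⊆p _ _ y∈) }

⋂ᶠ : ∀ {k n} → (Fin k → Subset n) → Subset n
⋂ᶠ X = tabulate λ x → does (all? λ i → x ∈? X i)

module _ {k n} {X : Fin k → Subset n} {x : Fin n} where

  ∈⋂ᶠ⁺ : (∀ i → x ∈ X i) → x ∈ ⋂ᶠ X
  ∈⋂ᶠ⁺ x∈X = lookup⇒[]= x (⋂ᶠ X) (trans (lookup∘tabulate _ x) (dec-true (all? λ i → x ∈? X i) x∈X))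

  ∈⋂ᶠ⁻ : x ∈ ⋂ᶠ X → ∀ i → x ∈ X i
  ∈⋂ᶠ⁻ x∈⋂ = decidable-stable (all? λ i → x ∈? X i) λ ¬∀ →
    contradiction
      (trans (sym (dec-false (all? λ i → x ∈? X i) ¬∀)) (trans (sym (lookup∘tabulate _ x)) ([]=⇒lookup x∈⋂)))
      λ ()

  ∉⋂ᶠ⁻ : x ∉ ⋂ᶠ X → ∃ λ i → x ∉ X i
  ∉⋂ᶠ⁻ x∉⋂ = ¬∀⟶∃¬ k _ (λ i → x ∈? X i) (x∉⋂ ∘ ∈⋂ᶠ⁺)

∀-punchIn⁻ : ∀ {k} {P : Fin (suc k) → Set} i → P i → (∀ j → P (punchIn i j)) → ∀ l → P l
∀-punchIn⁻ {P = P} i Pi P-punched l with i ≟ᶠ l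
... | yes refl = Pi
... | no  i≢l  = subst P (punchIn-punchOut i≢l) (P-punched (punchOut i≢l))

Common : ∀ {k n} → (Fin k → Subset n) → Set
Common X = ∃ λ x → ∀ i → x ∈ X i

common? : ∀ {k n} (X : Fin k → Subset n) → Dec (Common X)
common? X = any? λ x → all? λ i → x ∈? X i

common-by-induction : ∀ {n} {P : Subset n → Set} → Fin n →
  (∀ {k} (X : Fin (suc k) → Subset n) → (∀ i → P (X i)) → (∀ i → Common (X ∘ punchIn i)) → Common X) →
  ∀ {k} (X : Fin k → Subset n) → (∀ i → P (X i)) → Common X
common-by-induction x₀ step {zero}  X PX = x₀ , λ ()
common-by-induction {P = P} x₀ step {suc k} X PX =
  step X PX λ i → common-by-induction {P = P} x₀ step (X ∘ punchIn i) (PX ∘ punchIn i)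

common-point-of-all : ∀ {n} {P : Subset n → Set} → Decidable P →
  (∀ {k} (X : Fin k → Subset n) → (∀ i → P (X i)) → Common X) →
  ∃ λ t → ∀ Z → P Z → t ∈ Z
common-point-of-all {n} {P} P? common = t , λ Z PZ → t∈ (∈-filter⁺ P? (∈-subsets Z) PZ)
  where
  Ps : List (Subset n)
  Ps = filter P? (subsets n)
  common-point : Common (List.lookup Ps)
  common-point = common (List.lookup Ps) (λ i → proj₂ (∈-filter⁻ P? {xs = subsets n} (∈-lookup i)))
  t : Fin n
  t = proj₁ common-point
  t∈ : ∀ {Z} → Z ∈ₗ Ps → t ∈ Z
  t∈ Z∈Ps = subst (t ∈_) (sym (lookup-index Z∈Ps)) (proj₂ common-point (index Z∈Ps))

module _ (G : Digraph) {m : ℕ}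
  (cut≥m : ∀ {Z₁ Z₂} → IsDoubleCut (Z₁ , Z₂) → m ≤ ϱ G Z₁ + ϱ G Z₂) where

  Light : Subset (n G) → Set
  Light Z = NonemptyProper Z × 2 * ϱ G Z < m

  light? : Decidable Light
  light? Z = (nonempty? Z ×-dec nonempty? (∁ Z)) ×-dec (2 * ϱ G Z <? m)

  module WithoutCommonPoint {k} (X : Fin (suc k) → Subset (n G)) (¬common : ¬ Common X) where

    Y : Fin (suc k) → Subset (n G)
    Y i = ⋂ᶠ (X ∘ punchIn i)

    ∈Y⇒∉X : ∀ {i x} → x ∈ Y i → x ∉ X i
    ∈Y⇒∉X {i} x∈Y x∈X = ¬common (_ , ∀-punchIn⁻ i x∈X (∈⋂ᶠ⁻ x∈Y))

    Y-disjoint : ∀ {i j x} → x ∈ Y i → x ∈ Y j → i ≡ j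
    Y-disjoint {i} {j} x∈Yi x∈Yj with j ≟ᶠ i
    ... | yes j≡i = sym j≡i
    ... | no  j≢i = contradiction (subst (λ l → _ ∈ X l) (punchIn-punchOut j≢i) (∈⋂ᶠ⁻ x∈Yj (punchOut j≢i))) (∈Y⇒∉X x∈Yi)

    entering-Y≤entering-X : ∀ a → sum (λ i → 𝟙 (enters (Y i) a)) ≤ sum (λ i → 𝟙 (enters (X i) a))
    entering-Y≤entering-X (u , v) =
      ∑-𝟙-≤ _ (λ i j ei ej → Y-disjoint (proj₂ (enters⁻ ei)) (proj₂ (enters⁻ ej))) enters-some-X
      where
      enters-some-X : ∀ i → enters (Y i) (u , v) ≡ true → 1 ≤ sum (λ l → 𝟙 (enters (X l) (u , v)))
      enters-some-X i e with enters⁻ {Z = Y i} e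
      ... | u∉Y , v∈Y with ∉⋂ᶠ⁻ {X = X ∘ punchIn i} u∉Y
      ... | j , u∉X = subst (λ b → 𝟙 b ≤ sum (λ l → 𝟙 (enters (X l) (u , v))))
          (enters⁺ {Z = X (punchIn i j)} u∉X (∈⋂ᶠ⁻ {X = X ∘ punchIn i} v∈Y j))
          (f≤∑f (λ l → 𝟙 (enters (X l) (u , v))) (punchIn i j))

    ∑ϱY≤∑ϱX : sum (ϱ G ∘ Y) ≤ sum (ϱ G ∘ X)
    ∑ϱY≤∑ϱX = ∑-count-mono (enters ∘ Y) (enters ∘ X) entering-Y≤entering-X (arcs G)

    doubleCut : ∀ i → NonemptyProper (X i) → Common (X ∘ punchIn i) → IsDoubleCut (Y i , X i)
    doubleCut i X-proper@((x , x∈X) , _) (y , y∈X) =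
      ((y , ∈⋂ᶠ⁺ y∈X) , (x , x∉p⇒x∈∁p λ x∈Y → ∈Y⇒∉X x∈Y x∈X)) , X-proper ,
      λ { (z , z∈) → ∈Y⇒∉X (p∩q⊆p _ _ z∈) (p∩q⊆q _ _ z∈) }

    impossible : (∀ i → Light (X i)) → (∀ i → Common (X ∘ punchIn i)) → ⊥
    impossible light common = <-irrefl refl (begin-strict
      ∑ϱX + ∑ϱX                              ≡⟨ ∑-distrib-+ (ϱ G ∘ X) (ϱ G ∘ X) ⟨
      sum (λ i → ϱ G (X i) + ϱ G (X i))      <⟨ ∑-mono-< (λ i → <-≤-trans (twice<m i) (cut≥m (doubleCut i (proj₁ (light i)) (common i)))) ⟩
      sum (λ i → ϱ G (Y i) + ϱ G (X i))      ≡⟨ ∑-distrib-+ (ϱ G ∘ Y) (ϱ G ∘ X) ⟩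
      sum (ϱ G ∘ Y) + ∑ϱX                    ≤⟨ +-monoˡ-≤ ∑ϱX ∑ϱY≤∑ϱX ⟩
      ∑ϱX + ∑ϱX                              ∎)
      where
      open ≤-Reasoning
      ∑ϱX = sum (ϱ G ∘ X)
      twice<m : ∀ i → ϱ G (X i) + ϱ G (X i) < m
      twice<m i = subst (_< m) (cong (ϱ G (X i) +_) (+-identityʳ _)) (proj₂ (light i))

  light-sets-common : ∀ {k} (X : Fin (suc k) → Subset (n G)) → (∀ i → Light (X i)) →
    (∀ i → Common (X ∘ punchIn i)) → Common X
  light-sets-common X light common with common? X
  ... | yes c  = c
  ... | no ¬c = ⊥-elim (WithoutCommonPoint.impossible X ¬c light common)

  light-sets-share-a-node : Fin (n G) → ∃ λ t → ∀ Z → Light Z → t ∈ Z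
  light-sets-share-a-node t₀ = common-point-of-all light? (common-by-induction {P = Light} t₀ light-sets-common)

  m≤2ϱ-if-avoiding : ∀ {t} → (∀ Z → Light Z → t ∈ Z) → (Z : Subset (n G)) → Nonempty Z → t ∉ Z → m ≤ 2 * ϱ G Z
  m≤2ϱ-if-avoiding {t} t∈light Z Z≠∅ t∉Z with m ≤? 2 * ϱ G Z
  ... | yes m≤ = m≤
  ... | no  m≰ = contradiction (t∈light Z ((Z≠∅ , (t , x∉p⇒x∈∁p t∉Z)) , ≰⇒> m≰)) t∉Z

theorem4 : (G : Digraph) → (t₀ : Fin (n G)) →
    Σ (Fin (n G)) (λ t → (Z : Subset (n G)) → Nonempty Z → t ∉ Z → μ G ≤∞ (2 * ϱ G Z))
theorem4 G t₀ with μ G | μ-≤ G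
... | just m  | μ≤ = let t , t∈light = light-sets-share-a-node G μ≤ t₀ in t , m≤2ϱ-if-avoiding G μ≤ t∈light
... | nothing | μ≤ = t₀ , λ Z Z≠∅ t₀∉Z → μ≤ (doubleCut-∁ (Z≠∅ , (t₀ , x∉p⇒x∈∁p t₀∉Z)))
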